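{- Let $(\Sigma,P)$ be a string rewrite system. Every proof term $\gamma$ can be (effectively) transformed into a greedy multistep reduction $\gamma'$ that is permutation equivalent to $\gamma$.
   Context: An alphabet $\Sigma$ has unique reading; strings are elements of the free monoid over $\Sigma$ with empty string $\varepsilon$. A string rewrite system $(\Sigma,P)$ has rules $\varrho:\ell\to r$ with $\ell,r$ nonempty strings. Proof terms are built from $\varepsilon$, letters, rule symbols, juxtaposition $\gamma\delta$ and vertical composition $\gamma\cdot\delta$, with sources and targets $\gamma:s\Rightarrow t$: $\varepsilon:\varepsilon\Rightarrow\varepsilon$; $a:a\Rightarrow a$; $\varrho:\ell\Rightarrow r$; $\gamma_1\gamma_2:s_1s_2\Rightarrow t_1t_2$ if $\gamma_i:s_i\Rightarrow t_i$; $\gamma\cdot\delta:s\Rightarrow u$ if $\gamma:s\Rightarrow t,\ \delta:t\Rightarrow u$ (string equality modulo monoid laws). Permutation equivalence is the congruence on proof terms generated by (both sides required to be proof terms) $\varepsilon\gamma=\gamma$, $\gamma\varepsilon=\gamma$, $(\gamma\delta)\zeta=\gamma(\delta\zeta)$, $s\cdot\gamma=\gamma$, $\gamma\cdot t=\gamma$ (strings $s,t$), $(\gamma\cdot\delta)\cdot\zeta=\gamma\cdot(\delta\cdot\zeta)$, $\gamma\delta\cdot\zeta\eta=(\gamma\cdot\zeta)(\delta\cdot\eta)$. A multistep is a proof term with no vertical composition; it is a step if it contains exactly one rule-symbol occurrence and empty if it contains none. A multistep reduction is an empty multistep or a right-associated vertical composition of nonempty multisteps. For multisteps $\Phi,\Psi$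 with the same source, $\Phi\le\Psi$ ($\Phi$ contained in $\Psi$) means $\Phi$ is obtained from $\Psi$ by replacing some occurrences of rule symbols by their left-hand sides; then the residual $\Psi/\Phi$ is obtained from $\Psi$ by replacing the other occurrences (those still present as rules in $\Phi$) by their right-hand sides. A pair $\Phi\cdot\Psi$ of consecutive multisteps is loath if there is a multistep $X$ with the same source as $\Phi$ such that $\Phi\le X$, the residual $\psi:=X/\Phi$ is a step, and $\psi\le\Psi$. A proof term is greedy if it is a multistep reduction in which no pair of consecutive multisteps is loath. -}

module Defs where

open import Data.Nat using (ℕ; zero; suc; _+_)
open import Data.List using (List; []; _∷_; _++_; map)
open import Data.Sum using (_⊎_; inj₁; inj₂)
open import Data.Product using (Σ; ∃; ∃-syntax; _×_; _,_)
open import Relation.Nullary using (¬_)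
open import Relation.Binary.PropositionalEquality using (_≡_; _≢_)

record SRS : Set₁ where
  field
    Alph  : Set
    Rule  : Set
    lhs   : Rule → List Alph
    rhs   : Rule → List Alph
    lhs-nonempty : ∀ ρ → lhs ρ ≢ []
    rhs-nonempty : ∀ ρ → rhs ρ ≢ []

module _ (R : SRS) where
  open SRS R

  infixl 7 _⊗_
  infixr 5 _∙_
  data Term : Set where
    ε    : Term
    lt   : Alph → Term
    rl   : Rule → Term
    _⊗_  : Term → Term → Term
    _∙_  : Term → Term → Term

  data _∶_⇒_ : Term → List Alph → List Alph → Set where
    ε⇒  : ε ∶ [] ⇒ []
    lt⇒ : ∀ a → lt a ∶ (a ∷ []) ⇒ (a ∷ [])
    rl⇒ : ∀ ρ → rl ρ ∶ lhs ρ ⇒ rhs ρ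
    ⊗⇒  : ∀ {γ₁ γ₂ s₁ s₂ t₁ t₂} → γ₁ ∶ s₁ ⇒ t₁ → γ₂ ∶ s₂ ⇒ t₂ →
          (γ₁ ⊗ γ₂) ∶ (s₁ ++ s₂) ⇒ (t₁ ++ t₂)
    ∙⇒  : ∀ {γ δ s t u} → γ ∶ s ⇒ t → δ ∶ t ⇒ u → (γ ∙ δ) ∶ s ⇒ u

  PT : Term → Set
  PT γ = ∃[ s ] ∃[ t ] (γ ∶ s ⇒ t)

  data Multistep : Term → Set where
    ε-ms  : Multistep ε
    lt-ms : ∀ a → Multistep (lt a)
    rl-ms : ∀ ρ → Multistep (rl ρ)
    ⊗-ms  : ∀ {γ δ} → Multistep γ → Multistep δ → Multistep (γ ⊗ δ)

  #rules : Term → ℕ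
  #rules ε = 0
  #rules (lt a) = 0
  #rules (rl ρ) = 1
  #rules (γ ⊗ δ) = #rules γ + #rules δ
  #rules (γ ∙ δ) = #rules γ + #rules δ

  IsString : Term → Set
  IsString γ = Multistep γ × #rules γ ≡ 0

  infix 4 _≈_
  data _≈_ : Term → Term → Set where
    ≈-refl  : ∀ {γ} → PT γ → γ ≈ γ
    ≈-sym   : ∀ {γ δ} → γ ≈ δ → δ ≈ γ
    ≈-trans : ∀ {γ δ ζ} → γ ≈ δ → δ ≈ ζ → γ ≈ ζ
    ≈-⊗     : ∀ {γ γ' δ δ'} → γ ≈ γ' → δ ≈ δ' → (γ ⊗ δ) ≈ (γ' ⊗ δ')
    ≈-∙     : ∀ {γ γ' δ δ'} → PT (γ ∙ δ) → PT (γ' ∙ δ') →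
              γ ≈ γ' → δ ≈ δ' → (γ ∙ δ) ≈ (γ' ∙ δ')
    unitˡ   : ∀ {γ} → PT (ε ⊗ γ) → PT γ → (ε ⊗ γ) ≈ γ
    unitʳ   : ∀ {γ} → PT (γ ⊗ ε) → PT γ → (γ ⊗ ε) ≈ γ
    assoc⊗  : ∀ {γ δ ζ} → PT ((γ ⊗ δ) ⊗ ζ) → PT (γ ⊗ (δ ⊗ ζ)) →
              ((γ ⊗ δ) ⊗ ζ) ≈ (γ ⊗ (δ ⊗ ζ))
    idˡ     : ∀ {s γ} → IsString s → PT (s ∙ γ) → PT γ → (s ∙ γ) ≈ γ
    idʳ     : ∀ {γ t} → IsString t → PT (γ ∙ t) → PT γ → (γ ∙ t) ≈ γ
    assoc∙  : ∀ {γ δ ζ} → PT ((γ ∙ δ) ∙ ζ) → PT (γ ∙ (δ ∙ ζ)) →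
              ((γ ∙ δ) ∙ ζ) ≈ (γ ∙ (δ ∙ ζ))
    exch    : ∀ {γ δ ζ η} → PT ((γ ⊗ δ) ∙ (ζ ⊗ η)) → PT ((γ ∙ ζ) ⊗ (δ ∙ η)) →
              ((γ ⊗ δ) ∙ (ζ ⊗ η)) ≈ ((γ ∙ ζ) ⊗ (δ ∙ η))

  -- Multisteps modulo the monoid laws of juxtaposition are words over
  -- letters and rule symbols.
  Word : Set
  Word = List (Alph ⊎ Rule)

  flat : Term → Word
  flat ε = []
  flat (lt a) = inj₁ a ∷ []
  flat (rl ρ) = inj₂ ρ ∷ []
  flat (γ ⊗ δ) = flat γ ++ flat δ
  flat (γ ∙ δ) = flat γ ++ flat δ   -- not used for multisteps

  letters : List Alph → Word
  letters = map inj₁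

  #rulesW : Word → ℕ
  #rulesW [] = 0
  #rulesW (inj₁ _ ∷ w) = #rulesW w
  #rulesW (inj₂ _ ∷ w) = suc (#rulesW w)

  -- An inhabitant records which
  -- occurrences were replaced (it is unique since left-hand sides are nonempty).
  data _≤ₘ_ : Word → Word → Set where
    []≤   : [] ≤ₘ []
    lt≤   : ∀ {Φ Ψ} a → Φ ≤ₘ Ψ → (inj₁ a ∷ Φ) ≤ₘ (inj₁ a ∷ Ψ)
    keep≤ : ∀ {Φ Ψ} ρ → Φ ≤ₘ Ψ → (inj₂ ρ ∷ Φ) ≤ₘ (inj₂ ρ ∷ Ψ)
    drop≤ : ∀ {Φ Ψ} ρ → Φ ≤ₘ Ψ → (letters (lhs ρ) ++ Φ) ≤ₘ (inj₂ ρ ∷ Ψ)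

  resid : ∀ {Φ Ψ} → Φ ≤ₘ Ψ → Word
  resid []≤ = []
  resid (lt≤ a p) = inj₁ a ∷ resid p
  resid (keep≤ ρ p) = letters (rhs ρ) ++ resid p
  resid (drop≤ ρ p) = inj₂ ρ ∷ resid p

  Loath : Word → Word → Set
  Loath Φ Ψ = ∃[ X ] Σ (Φ ≤ₘ X) λ p →
                #rulesW (resid p) ≡ 1 × (resid p ≤ₘ Ψ)

  headMS : Term → Term
  headMS (γ ∙ δ) = γ
  headMS γ = γ

  data GreedyNE : Term → Set where
    one  : ∀ {Φ} → Multistep Φ → #rules Φ ≢ 0 → GreedyNE Φ
    cons : ∀ {Φ δ} → Multistep Φ → #rules Φ ≢ 0 → GreedyNE δ →
           ¬ Loath (flat Φ) (flat (headMS δ)) → GreedyNE (Φ ∙ δ)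

  Greedy : Term → Set
  Greedy γ = IsString γ ⊎ GreedyNE γ

module Submission where

-- A proof term is first normalised to a multistep reduction: the interchange law
-- (γ δ) · (ζ η) = (γ · ζ)(δ · η), with identity strings as padding, pushes every
-- juxtaposition below the vertical compositions, and identities are absorbed by the
-- unit laws. Then loath pairs are removed one at a time. If Φ · Ψ is loath, Ψ contains
-- a rule symbol ρ whose left-hand side Φ leaves as letters exactly where ρ is applied;
-- by interchange ρ can be performed in Φ instead, Φ · Ψ ≈ Φ' · Ψ', so one rule symbol
-- moves one multistep earlier (and Ψ' is dropped if no rule symbol is left in it).
-- Weighting each rule symbol by the position of its multistep, every such move lowers
-- the total weight, so the process ends in a greedy reduction. Loathness is decidable
-- although the alphabet has no decidable equality: composability fixes the letters,
-- so only positions and lengths need to be compared.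

open import Defs
open import Data.List using (List; []; _∷_; _++_; [_]; concatMap; length)
open import Data.List.Properties using (++-assoc; ++-identityʳ; concatMap-++; map-++; ∷-injective; ++-cancelˡ)
open import Data.Nat using (ℕ; zero; suc; _+_; _≤_; _<_; _≟_)
open import Data.Nat.Properties
  using (suc-injective; 1+n≢0; +-identityʳ; +-suc; +-mono-≤-<; ≤-reflexive; ≤-refl; ≤-<-trans; m≤n+m; n<1+n)
open import Data.Nat.Induction using (<-wellFounded)
open import Data.Product using (Σ; ∃-syntax; ∃₂; _×_; _,_; proj₂)
open import Data.Sum using (_⊎_; inj₁; inj₂)
open import Data.Empty using (⊥)
open import Function using (_∘_)
open import Induction.WellFounded using (Acc; acc)
open import Relation.Binary.Bundles using (PartialSetoid)
open import Relation.Binary.PropositionalEquality using (_≡_; _≢_; refl; sym; trans; cong; cong₂; subst; subst₂)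
open import Relation.Nullary using (¬_; Dec; yes; no)
open import Relation.Nullary.Decidable using (map′; _×-dec_; _⊎-dec_)

splits? : ∀ {A : Set} {P : List A → List A → Set} → (∀ xs ys → Dec (P xs ys)) →
          ∀ zs → Dec (∃₂ λ xs ys → zs ≡ xs ++ ys × P xs ys)
splits? {P = P} P? [] = map′ (λ p → [] , [] , refl , p) from (P? [] [])
  where
    from : ∃₂ (λ xs ys → [] ≡ xs ++ ys × P xs ys) → P [] []
    from ([] , [] , refl , p) = p
splits? {P = P} P? (z ∷ zs) = map′ to from (P? [] (z ∷ zs) ⊎-dec splits? (λ xs → P? (z ∷ xs)) zs)
  where
    to : P [] (z ∷ zs) ⊎ ∃₂ (λ xs ys → zs ≡ xs ++ ys × P (z ∷ xs) ys) →
         ∃₂ λ xs ys → z ∷ zs ≡ xs ++ ys × P xs ys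
    to (inj₁ p) = [] , z ∷ zs , refl , p
    to (inj₂ (xs , ys , refl , p)) = z ∷ xs , ys , refl , p
    from : ∃₂ (λ xs ys → z ∷ zs ≡ xs ++ ys × P xs ys) →
           P [] (z ∷ zs) ⊎ ∃₂ (λ xs ys → zs ≡ xs ++ ys × P (z ∷ xs) ys)
    from ([] , _ , refl , p) = inj₁ p
    from (x ∷ xs , ys , refl , p) = inj₂ (xs , ys , refl , p)

++-cancel-length : ∀ {A : Set} (xs ys xs' ys' : List A) → length xs ≡ length xs' →
                   xs ++ ys ≡ xs' ++ ys' → xs ≡ xs' × ys ≡ ys'
++-cancel-length [] ys [] ys' _ e = refl , e
++-cancel-length (x ∷ xs) ys (x' ∷ xs') ys' len e with ∷-injective e
... | refl , e' with ++-cancel-length xs ys xs' ys' (suc-injective len) e'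
...   | refl , e'' = refl , e''

module Greedification (R : SRS) where
  open SRS R

  infix 4 _⦂_⇒_ _≋_

  _⦂_⇒_ : Term R → List Alph → List Alph → Set
  _⦂_⇒_ = _∶_⇒_ R

  _≋_ : Term R → Term R → Set
  _≋_ = _≈_ R

  W : Set
  W = Word R

  #ʳ : W → ℕ
  #ʳ = #rulesW R

  ≋-partialSetoid : PartialSetoid _ _
  ≋-partialSetoid = record
    { Carrier = Term R ; _≈_ = _≋_
    ; isPartialEquivalence = record { sym = ≈-sym ; trans = ≈-trans } }

  open import Relation.Binary.Reasoning.PartialSetoid ≋-partialSetoid

  atom : Alph ⊎ Rule → Term R
  atom (inj₁ a) = lt a
  atom (inj₂ ρ) = rl ρ

  toTerm : W → Term R
  toTerm [] = ε
  toTerm (x ∷ w) = atom x ⊗ toTerm w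

  srcSym tgtSym : Alph ⊎ Rule → List Alph
  srcSym (inj₁ a) = [ a ]
  srcSym (inj₂ ρ) = lhs ρ
  tgtSym (inj₁ a) = [ a ]
  tgtSym (inj₂ ρ) = rhs ρ

  src tgt : W → List Alph
  src = concatMap srcSym
  tgt = concatMap tgtSym

  atom-⦂ : ∀ x → atom x ⦂ srcSym x ⇒ tgtSym x
  atom-⦂ (inj₁ a) = lt⇒ a
  atom-⦂ (inj₂ ρ) = rl⇒ ρ

  toTerm-⦂ : ∀ w → toTerm w ⦂ src w ⇒ tgt w
  toTerm-⦂ [] = ε⇒
  toTerm-⦂ (x ∷ w) = ⊗⇒ (atom-⦂ x) (toTerm-⦂ w)

  retype : ∀ {γ s t s' t'} → γ ⦂ s ⇒ t → s ≡ s' → t ≡ t' → γ ⦂ s' ⇒ t'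
  retype γ⦂ refl refl = γ⦂

  src-letters : ∀ l → src (letters R l) ≡ l
  src-letters [] = refl
  src-letters (a ∷ l) = cong (a ∷_) (src-letters l)

  tgt-letters : ∀ l → tgt (letters R l) ≡ l
  tgt-letters [] = refl
  tgt-letters (a ∷ l) = cong (a ∷_) (tgt-letters l)

  src-letters-++ : ∀ l w → src (letters R l ++ w) ≡ l ++ src w
  src-letters-++ l w = trans (concatMap-++ srcSym (letters R l) w) (cong (_++ src w) (src-letters l))

  tgt-letters-++ : ∀ l w → tgt (letters R l ++ w) ≡ l ++ tgt w
  tgt-letters-++ l w = trans (concatMap-++ tgtSym (letters R l) w) (cong (_++ tgt w) (tgt-letters l))

  src-split : ∀ Ψ₁ l Ψ₂ → src (Ψ₁ ++ letters R l ++ Ψ₂) ≡ src Ψ₁ ++ l ++ src Ψ₂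
  src-split Ψ₁ l Ψ₂ = trans (concatMap-++ srcSym Ψ₁ _) (cong (src Ψ₁ ++_) (src-letters-++ l Ψ₂))

  tgt-split : ∀ Φ₁ l Φ₂ → tgt (Φ₁ ++ letters R l ++ Φ₂) ≡ tgt Φ₁ ++ l ++ tgt Φ₂
  tgt-split Φ₁ l Φ₂ = trans (concatMap-++ tgtSym Φ₁ _) (cong (tgt Φ₁ ++_) (tgt-letters-++ l Φ₂))

  composable-split : ∀ Φ₁ l Φ₂ Ψ₁ ρ Ψ₂ → tgt (Φ₁ ++ letters R l ++ Φ₂) ≡ src (Ψ₁ ++ inj₂ ρ ∷ Ψ₂) →
                     tgt Φ₁ ++ l ++ tgt Φ₂ ≡ src Ψ₁ ++ lhs ρ ++ src Ψ₂
  composable-split Φ₁ l Φ₂ Ψ₁ ρ Ψ₂ e = trans (sym (tgt-split Φ₁ l Φ₂)) (trans e (concatMap-++ srcSym Ψ₁ _))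

  #ʳ-++ : ∀ u v → #ʳ (u ++ v) ≡ #ʳ u + #ʳ v
  #ʳ-++ [] v = refl
  #ʳ-++ (inj₁ a ∷ u) v = #ʳ-++ u v
  #ʳ-++ (inj₂ ρ ∷ u) v = cong suc (#ʳ-++ u v)

  #ʳ-letters : ∀ l → #ʳ (letters R l) ≡ 0
  #ʳ-letters [] = refl
  #ʳ-letters (a ∷ l) = #ʳ-letters l

  #ʳ-letters-++ : ∀ l w → #ʳ (letters R l ++ w) ≡ #ʳ w
  #ʳ-letters-++ l w = trans (#ʳ-++ (letters R l) w) (cong (_+ #ʳ w) (#ʳ-letters l))

  #ʳ-++-letters : ∀ w l → #ʳ (w ++ letters R l) ≡ #ʳ w
  #ʳ-++-letters w l = trans (#ʳ-++ w (letters R l)) (trans (cong (#ʳ w +_) (#ʳ-letters l)) (+-identityʳ (#ʳ w)))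

  rulefree-src≡tgt : ∀ w → #ʳ w ≡ 0 → src w ≡ tgt w
  rulefree-src≡tgt [] _ = refl
  rulefree-src≡tgt (inj₁ a ∷ w) none = cong (a ∷_) (rulefree-src≡tgt w none)

  flat-toTerm : ∀ w → flat R (toTerm w) ≡ w
  flat-toTerm [] = refl
  flat-toTerm (inj₁ a ∷ w) = cong (inj₁ a ∷_) (flat-toTerm w)
  flat-toTerm (inj₂ ρ ∷ w) = cong (inj₂ ρ ∷_) (flat-toTerm w)

  headMS-toTerm : ∀ w → headMS R (toTerm w) ≡ toTerm w
  headMS-toTerm [] = refl
  headMS-toTerm (x ∷ w) = refl

  toTerm-multistep : ∀ w → Multistep R (toTerm w)
  toTerm-multistep [] = ε-ms
  toTerm-multistep (inj₁ a ∷ w) = ⊗-ms (lt-ms a) (toTerm-multistep w)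
  toTerm-multistep (inj₂ ρ ∷ w) = ⊗-ms (rl-ms ρ) (toTerm-multistep w)

  #rules-toTerm : ∀ w → #rules R (toTerm w) ≡ #ʳ w
  #rules-toTerm [] = refl
  #rules-toTerm (inj₁ a ∷ w) = #rules-toTerm w
  #rules-toTerm (inj₂ ρ ∷ w) = cong suc (#rules-toTerm w)

  toTerm-string : ∀ w → #ʳ w ≡ 0 → IsString R (toTerm w)
  toTerm-string w none = toTerm-multistep w , trans (#rules-toTerm w) none

  idTerm : List Alph → Term R
  idTerm s = toTerm (letters R s)

  idTerm-⦂ : ∀ s → idTerm s ⦂ s ⇒ s
  idTerm-⦂ s = retype (toTerm-⦂ (letters R s)) (src-letters s) (tgt-letters s)

  idTerm-string : ∀ s → IsString R (idTerm s)
  idTerm-string s = toTerm-string (letters R s) (#ʳ-letters s)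

  ≋-refl : ∀ {γ s t} → γ ⦂ s ⇒ t → γ ≋ γ
  ≋-refl γ⦂ = ≈-refl (_ , _ , γ⦂)

  ∙-cong : ∀ {γ γ' δ δ' s t u s' t' u'} → γ ⦂ s ⇒ t → δ ⦂ t ⇒ u → γ' ⦂ s' ⇒ t' → δ' ⦂ t' ⇒ u' →
           γ ≋ γ' → δ ≋ δ' → γ ∙ δ ≋ γ' ∙ δ'
  ∙-cong γ⦂ δ⦂ γ'⦂ δ'⦂ = ≈-∙ (_ , _ , ∙⇒ γ⦂ δ⦂) (_ , _ , ∙⇒ γ'⦂ δ'⦂)

  ∙-assoc : ∀ {γ δ ζ s t u v} → γ ⦂ s ⇒ t → δ ⦂ t ⇒ u → ζ ⦂ u ⇒ v →
            (γ ∙ δ) ∙ ζ ≋ γ ∙ (δ ∙ ζ)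
  ∙-assoc γ⦂ δ⦂ ζ⦂ = assoc∙ (_ , _ , ∙⇒ (∙⇒ γ⦂ δ⦂) ζ⦂) (_ , _ , ∙⇒ γ⦂ (∙⇒ δ⦂ ζ⦂))

  interchange : ∀ {γ δ ζ η s₁ t₁ u₁ s₂ t₂ u₂} →
                γ ⦂ s₁ ⇒ t₁ → ζ ⦂ t₁ ⇒ u₁ → δ ⦂ s₂ ⇒ t₂ → η ⦂ t₂ ⇒ u₂ →
                (γ ⊗ δ) ∙ (ζ ⊗ η) ≋ (γ ∙ ζ) ⊗ (δ ∙ η)
  interchange γ⦂ ζ⦂ δ⦂ η⦂ =
    exch (_ , _ , ∙⇒ (⊗⇒ γ⦂ δ⦂) (⊗⇒ ζ⦂ η⦂)) (_ , _ , ⊗⇒ (∙⇒ γ⦂ ζ⦂) (∙⇒ δ⦂ η⦂))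

  ∙-unitˡ : ∀ {σ γ s t u} → IsString R σ → σ ⦂ s ⇒ t → γ ⦂ t ⇒ u → σ ∙ γ ≋ γ
  ∙-unitˡ σ-str σ⦂ γ⦂ = idˡ σ-str (_ , _ , ∙⇒ σ⦂ γ⦂) (_ , _ , γ⦂)

  ∙-unitʳ : ∀ {σ γ s t u} → IsString R σ → γ ⦂ s ⇒ t → σ ⦂ t ⇒ u → γ ∙ σ ≋ γ
  ∙-unitʳ σ-str γ⦂ σ⦂ = idʳ σ-str (_ , _ , ∙⇒ γ⦂ σ⦂) (_ , _ , γ⦂)

  toTerm-++ : ∀ u v → toTerm (u ++ v) ≋ toTerm u ⊗ toTerm v
  toTerm-++ [] v = ≈-sym (unitˡ (_ , _ , ⊗⇒ ε⇒ (toTerm-⦂ v)) (_ , _ , toTerm-⦂ v))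
  toTerm-++ (x ∷ u) v = begin
    atom x ⊗ toTerm (u ++ v)          ≈⟨ ≈-⊗ (≋-refl (atom-⦂ x)) (toTerm-++ u v) ⟩
    atom x ⊗ (toTerm u ⊗ toTerm v)    ≈⟨ assoc⊗ (_ , _ , ⊗⇒ (⊗⇒ x⦂ u⦂) v⦂) (_ , _ , ⊗⇒ x⦂ (⊗⇒ u⦂ v⦂)) ⟨
    (atom x ⊗ toTerm u) ⊗ toTerm v    ∎
    where x⦂ = atom-⦂ x ; u⦂ = toTerm-⦂ u ; v⦂ = toTerm-⦂ v

  idTerm-++ : ∀ s t → idTerm (s ++ t) ≋ idTerm s ⊗ idTerm t
  idTerm-++ s t = subst (λ w → toTerm w ≋ idTerm s ⊗ idTerm t) (sym (map-++ inj₁ s t))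
                        (toTerm-++ (letters R s) (letters R t))

  idTerm-idem : ∀ s → idTerm s ∙ idTerm s ≋ idTerm s
  idTerm-idem s = ∙-unitˡ (idTerm-string s) (idTerm-⦂ s) (idTerm-⦂ s)

  -- Multistep reductions

  record Multistep⁺ (s t : List Alph) : Set where
    field
      word     : W
      nonempty : #ʳ word ≢ 0
      source   : src word ≡ s
      target   : tgt word ≡ t

  open Multistep⁺

  term : ∀ {s t} → Multistep⁺ s t → Term R
  term m = toTerm (word m)

  term-⦂ : ∀ {s t} (m : Multistep⁺ s t) → term m ⦂ s ⇒ t
  term-⦂ m = retype (toTerm-⦂ (word m)) (source m) (target m)

  infixr 5 _∷_
  data Reduction : List Alph → List Alph → Set where
    []  : ∀ {s} → Reduction s s
    _∷_ : ∀ {s t u} → Multistep⁺ s t → Reduction t u → Reduction s u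

  ⟦_⟧ : ∀ {s t} → Reduction s t → Term R
  ⟦ [] {s} ⟧ = idTerm s
  ⟦ m ∷ [] ⟧ = term m
  ⟦ m ∷ q@(_ ∷ _) ⟧ = term m ∙ ⟦ q ⟧

  ⟦⟧-⦂ : ∀ {s t} (q : Reduction s t) → ⟦ q ⟧ ⦂ s ⇒ t
  ⟦⟧-⦂ [] = idTerm-⦂ _
  ⟦⟧-⦂ (m ∷ []) = term-⦂ m
  ⟦⟧-⦂ (m ∷ q@(_ ∷ _)) = ∙⇒ (term-⦂ m) (⟦⟧-⦂ q)

  ⟦∷⟧ : ∀ {s t u} (m : Multistep⁺ s t) (q : Reduction t u) → ⟦ m ∷ q ⟧ ≋ term m ∙ ⟦ q ⟧
  ⟦∷⟧ m [] = ≈-sym (∙-unitʳ (idTerm-string _) (term-⦂ m) (idTerm-⦂ _))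
  ⟦∷⟧ m q@(_ ∷ _) = ≋-refl (⟦⟧-⦂ (m ∷ q))

  infixr 5 _++ᴿ_
  _++ᴿ_ : ∀ {s t u} → Reduction s t → Reduction t u → Reduction s u
  [] ++ᴿ r = r
  (m ∷ q) ++ᴿ r = m ∷ (q ++ᴿ r)

  ⟦++ᴿ⟧ : ∀ {s t u} (q : Reduction s t) (r : Reduction t u) → ⟦ q ++ᴿ r ⟧ ≋ ⟦ q ⟧ ∙ ⟦ r ⟧
  ⟦++ᴿ⟧ [] r = ≈-sym (∙-unitˡ (idTerm-string _) (idTerm-⦂ _) (⟦⟧-⦂ r))
  ⟦++ᴿ⟧ (m ∷ q) r = begin
    ⟦ m ∷ (q ++ᴿ r) ⟧               ≈⟨ ⟦∷⟧ m (q ++ᴿ r) ⟩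
    term m ∙ ⟦ q ++ᴿ r ⟧            ≈⟨ ∙-cong m⦂ (⟦⟧-⦂ (q ++ᴿ r)) m⦂ (∙⇒ q⦂ r⦂) (≋-refl m⦂) (⟦++ᴿ⟧ q r) ⟩
    term m ∙ (⟦ q ⟧ ∙ ⟦ r ⟧)        ≈⟨ ∙-assoc m⦂ q⦂ r⦂ ⟨
    (term m ∙ ⟦ q ⟧) ∙ ⟦ r ⟧        ≈⟨ ∙-cong (∙⇒ m⦂ q⦂) r⦂ (⟦⟧-⦂ (m ∷ q)) r⦂ (≈-sym (⟦∷⟧ m q)) (≋-refl r⦂) ⟩
    ⟦ m ∷ q ⟧ ∙ ⟦ r ⟧               ∎
    where m⦂ = term-⦂ m ; q⦂ = ⟦⟧-⦂ q ; r⦂ = ⟦⟧-⦂ r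

  infixr 6 _◁ₘ_ _◁_
  infixl 6 _▷ₘ_ _▷_

  _◁ₘ_ : ∀ l {s t} → Multistep⁺ s t → Multistep⁺ (l ++ s) (l ++ t)
  l ◁ₘ m = record
    { word     = letters R l ++ word m
    ; nonempty = nonempty m ∘ trans (sym (#ʳ-letters-++ l (word m)))
    ; source   = trans (src-letters-++ l (word m)) (cong (l ++_) (source m))
    ; target   = trans (tgt-letters-++ l (word m)) (cong (l ++_) (target m)) }

  _▷ₘ_ : ∀ {s t} → Multistep⁺ s t → ∀ l → Multistep⁺ (s ++ l) (t ++ l)
  m ▷ₘ l = record
    { word     = word m ++ letters R l
    ; nonempty = nonempty m ∘ trans (sym (#ʳ-++-letters (word m) l))
    ; source   = trans (concatMap-++ srcSym (word m) (letters R l)) (cong₂ _++_ (source m) (src-letters l))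
    ; target   = trans (concatMap-++ tgtSym (word m) (letters R l)) (cong₂ _++_ (target m) (tgt-letters l)) }

  _◁_ : ∀ l {s t} → Reduction s t → Reduction (l ++ s) (l ++ t)
  l ◁ [] = []
  l ◁ (m ∷ q) = (l ◁ₘ m) ∷ (l ◁ q)

  _▷_ : ∀ {s t} → Reduction s t → ∀ l → Reduction (s ++ l) (t ++ l)
  [] ▷ l = []
  (m ∷ q) ▷ l = (m ▷ₘ l) ∷ (q ▷ l)

  ⟦◁⟧ : ∀ l {s t} (q : Reduction s t) → ⟦ l ◁ q ⟧ ≋ idTerm l ⊗ ⟦ q ⟧
  ⟦◁⟧ l {s} [] = idTerm-++ l s
  ⟦◁⟧ l (m ∷ q) = begin
    ⟦ (l ◁ₘ m) ∷ (l ◁ q) ⟧                    ≈⟨ ⟦∷⟧ (l ◁ₘ m) (l ◁ q) ⟩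
    term (l ◁ₘ m) ∙ ⟦ l ◁ q ⟧                 ≈⟨ ∙-cong (term-⦂ (l ◁ₘ m)) (⟦⟧-⦂ (l ◁ q)) (⊗⇒ l⦂ m⦂) (⊗⇒ l⦂ q⦂)
                                                         (toTerm-++ (letters R l) (word m)) (⟦◁⟧ l q) ⟩
    (idTerm l ⊗ term m) ∙ (idTerm l ⊗ ⟦ q ⟧)  ≈⟨ interchange l⦂ l⦂ m⦂ q⦂ ⟩
    (idTerm l ∙ idTerm l) ⊗ (term m ∙ ⟦ q ⟧)  ≈⟨ ≈-⊗ (idTerm-idem l) (≈-sym (⟦∷⟧ m q)) ⟩
    idTerm l ⊗ ⟦ m ∷ q ⟧                      ∎
    where l⦂ = idTerm-⦂ l ; m⦂ = term-⦂ m ; q⦂ = ⟦⟧-⦂ q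

  ⟦▷⟧ : ∀ {s t} (q : Reduction s t) l → ⟦ q ▷ l ⟧ ≋ ⟦ q ⟧ ⊗ idTerm l
  ⟦▷⟧ {s} [] l = idTerm-++ s l
  ⟦▷⟧ (m ∷ q) l = begin
    ⟦ (m ▷ₘ l) ∷ (q ▷ l) ⟧                    ≈⟨ ⟦∷⟧ (m ▷ₘ l) (q ▷ l) ⟩
    term (m ▷ₘ l) ∙ ⟦ q ▷ l ⟧                 ≈⟨ ∙-cong (term-⦂ (m ▷ₘ l)) (⟦⟧-⦂ (q ▷ l)) (⊗⇒ m⦂ l⦂) (⊗⇒ q⦂ l⦂)
                                                         (toTerm-++ (word m) (letters R l)) (⟦▷⟧ q l) ⟩
    (term m ⊗ idTerm l) ∙ (⟦ q ⟧ ⊗ idTerm l)  ≈⟨ interchange m⦂ q⦂ l⦂ l⦂ ⟩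
    (term m ∙ ⟦ q ⟧) ⊗ (idTerm l ∙ idTerm l)  ≈⟨ ≈-⊗ (≈-sym (⟦∷⟧ m q)) (idTerm-idem l) ⟩
    ⟦ m ∷ q ⟧ ⊗ idTerm l                      ∎
    where l⦂ = idTerm-⦂ l ; m⦂ = term-⦂ m ; q⦂ = ⟦⟧-⦂ q

  infixr 7 _∥_
  _∥_ : ∀ {s₁ t₁ s₂ t₂} → Reduction s₁ t₁ → Reduction s₂ t₂ → Reduction (s₁ ++ s₂) (t₁ ++ t₂)
  _∥_ {t₁ = t₁} {s₂} q₁ q₂ = (q₁ ▷ s₂) ++ᴿ (t₁ ◁ q₂)

  ⟦∥⟧ : ∀ {s₁ t₁ s₂ t₂} (q₁ : Reduction s₁ t₁) (q₂ : Reduction s₂ t₂) → ⟦ q₁ ∥ q₂ ⟧ ≋ ⟦ q₁ ⟧ ⊗ ⟦ q₂ ⟧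
  ⟦∥⟧ {t₁ = t₁} {s₂} q₁ q₂ = begin
    ⟦ (q₁ ▷ s₂) ++ᴿ (t₁ ◁ q₂) ⟧                  ≈⟨ ⟦++ᴿ⟧ (q₁ ▷ s₂) (t₁ ◁ q₂) ⟩
    ⟦ q₁ ▷ s₂ ⟧ ∙ ⟦ t₁ ◁ q₂ ⟧                    ≈⟨ ∙-cong (⟦⟧-⦂ (q₁ ▷ s₂)) (⟦⟧-⦂ (t₁ ◁ q₂)) (⊗⇒ q₁⦂ s₂⦂) (⊗⇒ t₁⦂ q₂⦂)
                                                            (⟦▷⟧ q₁ s₂) (⟦◁⟧ t₁ q₂) ⟩
    (⟦ q₁ ⟧ ⊗ idTerm s₂) ∙ (idTerm t₁ ⊗ ⟦ q₂ ⟧)  ≈⟨ interchange q₁⦂ t₁⦂ s₂⦂ q₂⦂ ⟩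
    (⟦ q₁ ⟧ ∙ idTerm t₁) ⊗ (idTerm s₂ ∙ ⟦ q₂ ⟧)  ≈⟨ ≈-⊗ (∙-unitʳ (idTerm-string t₁) q₁⦂ t₁⦂)
                                                        (∙-unitˡ (idTerm-string s₂) s₂⦂ q₂⦂) ⟩
    ⟦ q₁ ⟧ ⊗ ⟦ q₂ ⟧                              ∎
    where q₁⦂ = ⟦⟧-⦂ q₁ ; q₂⦂ = ⟦⟧-⦂ q₂ ; s₂⦂ = idTerm-⦂ s₂ ; t₁⦂ = idTerm-⦂ t₁

  singleRule : ∀ ρ → Multistep⁺ (lhs ρ) (rhs ρ)
  singleRule ρ = record
    { word = [ inj₂ ρ ] ; nonempty = λ () ; source = ++-identityʳ (lhs ρ) ; target = ++-identityʳ (rhs ρ) }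

  normalise : ∀ {γ s t} → γ ⦂ s ⇒ t → Σ (Reduction s t) λ q → γ ≋ ⟦ q ⟧
  normalise ε⇒ = [] , ≋-refl ε⇒
  normalise (lt⇒ a) = [] , ≈-sym (unitʳ (_ , _ , ⊗⇒ (lt⇒ a) ε⇒) (_ , _ , lt⇒ a))
  normalise (rl⇒ ρ) = singleRule ρ ∷ [] , ≈-sym (unitʳ (_ , _ , ⊗⇒ (rl⇒ ρ) ε⇒) (_ , _ , rl⇒ ρ))
  normalise (⊗⇒ γ⦂ δ⦂) with normalise γ⦂ | normalise δ⦂
  ... | q , γ≋q | r , δ≋r = q ∥ r , ≈-trans (≈-⊗ γ≋q δ≋r) (≈-sym (⟦∥⟧ q r))
  normalise (∙⇒ γ⦂ δ⦂) with normalise γ⦂ | normalise δ⦂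
  ... | q , γ≋q | r , δ≋r =
    q ++ᴿ r , ≈-trans (∙-cong γ⦂ δ⦂ (⟦⟧-⦂ q) (⟦⟧-⦂ r) γ≋q δ≋r) (≈-sym (⟦++ᴿ⟧ q r))

  -- Loath pairs

  record LoathWitness (Φ Ψ : W) : Set where
    field
      rule        : Rule
      Φ₁ Φ₂ Ψ₁ Ψ₂ : W
      Φ-split     : Φ ≡ Φ₁ ++ letters R (lhs rule) ++ Φ₂
      Ψ-split     : Ψ ≡ Ψ₁ ++ inj₂ rule ∷ Ψ₂
      aligned     : tgt Φ₁ ≡ src Ψ₁

  ≤ₘ-src : ∀ {Φ X} → _≤ₘ_ R Φ X → src Φ ≡ src X
  ≤ₘ-src []≤ = refl
  ≤ₘ-src (lt≤ a p) = cong (a ∷_) (≤ₘ-src p)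
  ≤ₘ-src (keep≤ ρ p) = cong (lhs ρ ++_) (≤ₘ-src p)
  ≤ₘ-src (drop≤ ρ p) = trans (src-letters-++ (lhs ρ) _) (cong (lhs ρ ++_) (≤ₘ-src p))

  rule-occurrence : ∀ w → #ʳ w ≢ 0 → ∃[ w₁ ] ∃[ ρ ] ∃[ w₂ ] w ≡ w₁ ++ inj₂ ρ ∷ w₂
  rule-occurrence [] some with some refl
  ... | ()
  rule-occurrence (inj₁ a ∷ w) some with rule-occurrence w some
  ... | w₁ , ρ , w₂ , refl = inj₁ a ∷ w₁ , ρ , w₂ , refl
  rule-occurrence (inj₂ ρ ∷ w) _ = [] , ρ , w , refl

  letters-++-split : ∀ l {V V₁ V₂ ρ} → letters R l ++ V ≡ V₁ ++ inj₂ ρ ∷ V₂ →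
                     ∃[ V₁' ] V₁ ≡ letters R l ++ V₁' × V ≡ V₁' ++ inj₂ ρ ∷ V₂
  letters-++-split [] {V₁ = V₁} e = V₁ , refl , e
  letters-++-split (a ∷ l) {V₁ = []} ()
  letters-++-split (a ∷ l) {V₁ = x ∷ V₁} e with ∷-injective e
  ... | refl , e' with letters-++-split l e'
  ...   | V₁' , refl , e'' = V₁' , refl , e''

  ≤ₘ-split-at-rule : ∀ {V Ψ V₁ ρ V₂} → _≤ₘ_ R V Ψ → V ≡ V₁ ++ inj₂ ρ ∷ V₂ →
                     ∃[ Ψ₁ ] ∃[ Ψ₂ ] Ψ ≡ Ψ₁ ++ inj₂ ρ ∷ Ψ₂ × _≤ₘ_ R V₁ Ψ₁
  ≤ₘ-split-at-rule {V₁ = []} []≤ ()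
  ≤ₘ-split-at-rule {V₁ = _ ∷ _} []≤ ()
  ≤ₘ-split-at-rule {V₁ = []} (lt≤ a p) ()
  ≤ₘ-split-at-rule {V₁ = x ∷ V₁} (lt≤ a p) e with ∷-injective e
  ... | refl , e' with ≤ₘ-split-at-rule p e'
  ...   | Ψ₁ , Ψ₂ , refl , p₁ = inj₁ a ∷ Ψ₁ , Ψ₂ , refl , lt≤ a p₁
  ≤ₘ-split-at-rule {V₁ = []} (keep≤ ρ p) refl = [] , _ , refl , []≤
  ≤ₘ-split-at-rule {V₁ = x ∷ V₁} (keep≤ ρ' p) e with ∷-injective e
  ... | refl , e' with ≤ₘ-split-at-rule p e'
  ...   | Ψ₁ , Ψ₂ , refl , p₁ = inj₂ ρ' ∷ Ψ₁ , Ψ₂ , refl , keep≤ ρ' p₁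
  ≤ₘ-split-at-rule (drop≤ ρ' p) e with letters-++-split (lhs ρ') e
  ... | V₁' , refl , e' with ≤ₘ-split-at-rule p e'
  ...   | Ψ₁ , Ψ₂ , refl , p₁ = inj₂ ρ' ∷ Ψ₁ , Ψ₂ , refl , drop≤ ρ' p₁

  resid-split-at-rule : ∀ {Φ X V₁ ρ V₂} (p : _≤ₘ_ R Φ X) → resid R p ≡ V₁ ++ inj₂ ρ ∷ V₂ →
                        ∃[ Φ₁ ] ∃[ Φ₂ ] Φ ≡ Φ₁ ++ letters R (lhs ρ) ++ Φ₂ × tgt Φ₁ ≡ src V₁
  resid-split-at-rule {V₁ = []} []≤ ()
  resid-split-at-rule {V₁ = _ ∷ _} []≤ ()
  resid-split-at-rule {V₁ = []} (lt≤ a p) ()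
  resid-split-at-rule {V₁ = x ∷ V₁} (lt≤ a p) e with ∷-injective e
  ... | refl , e' with resid-split-at-rule p e'
  ...   | Φ₁ , Φ₂ , refl , al = inj₁ a ∷ Φ₁ , Φ₂ , refl , cong (a ∷_) al
  resid-split-at-rule (keep≤ ρ' p) e with letters-++-split (rhs ρ') e
  ... | V₁' , refl , e' with resid-split-at-rule p e'
  ...   | Φ₁ , Φ₂ , refl , al =
    inj₂ ρ' ∷ Φ₁ , Φ₂ , refl , trans (cong (rhs ρ' ++_) al) (sym (src-letters-++ (rhs ρ') V₁'))
  resid-split-at-rule {V₁ = []} (drop≤ ρ p) refl = [] , _ , refl , refl
  resid-split-at-rule {V₁ = x ∷ V₁} (drop≤ ρ' p) e with ∷-injective e
  ... | refl , e' with resid-split-at-rule p e'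
  ...   | Φ₁ , Φ₂ , refl , al =
    letters R (lhs ρ') ++ Φ₁ , Φ₂ , sym (++-assoc (letters R (lhs ρ')) Φ₁ _) ,
    trans (tgt-letters-++ (lhs ρ') Φ₁) (cong (lhs ρ' ++_) al)

  loath⇒witness : ∀ {Φ Ψ} → Loath R Φ Ψ → LoathWitness Φ Ψ
  loath⇒witness (X , p , one-rule , q) with rule-occurrence (resid R p) (1+n≢0 ∘ trans (sym one-rule))
  ... | V₁ , ρ , V₂ , e with resid-split-at-rule p e | ≤ₘ-split-at-rule q e
  ...   | Φ₁ , Φ₂ , eΦ , al | Ψ₁ , Ψ₂ , eΨ , V₁≤Ψ₁ = record
    { rule = ρ ; Φ₁ = Φ₁ ; Φ₂ = Φ₂ ; Ψ₁ = Ψ₁ ; Ψ₂ = Ψ₂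
    ; Φ-split = eΦ ; Ψ-split = eΨ ; aligned = trans al (≤ₘ-src V₁≤Ψ₁) }

  LettersPrefix : ℕ → W → Set
  LettersPrefix k w = ∃[ l ] ∃[ w' ] w ≡ letters R l ++ w' × length l ≡ k

  lettersPrefix? : ∀ k w → Dec (LettersPrefix k w)
  lettersPrefix? zero w = yes ([] , w , refl , refl)
  lettersPrefix? (suc k) [] = no λ { ([] , _ , _ , ()) ; (_ ∷ _ , _ , () , _) }
  lettersPrefix? (suc k) (inj₂ ρ ∷ w) = no λ { ([] , _ , _ , ()) ; (_ ∷ _ , _ , () , _) }
  lettersPrefix? (suc k) (inj₁ a ∷ w) = map′ extend shrink (lettersPrefix? k w)
    where
      extend : LettersPrefix k w → LettersPrefix (suc k) (inj₁ a ∷ w)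
      extend (l , w' , refl , refl) = a ∷ l , w' , refl , refl
      shrink : LettersPrefix (suc k) (inj₁ a ∷ w) → LettersPrefix k w
      shrink (_ ∷ l , w' , refl , refl) = l , w' , refl , refl

  -- Only lengths are compared; for composable Φ and Ψ the block of letters found in Φ
  -- is then forced to be lhs ρ (candidate⇒witness).
  RuleAt : W → W → W → Set
  RuleAt Φ Ψ₁ (inj₂ ρ ∷ _) =
    ∃₂ λ Φ₁ Φ' → Φ ≡ Φ₁ ++ Φ' × (length (tgt Φ₁) ≡ length (src Ψ₁) × LettersPrefix (length (lhs ρ)) Φ')
  RuleAt Φ Ψ₁ _ = ⊥

  ruleAt? : ∀ Φ Ψ₁ Ψ' → Dec (RuleAt Φ Ψ₁ Ψ')
  ruleAt? Φ Ψ₁ [] = no λ ()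
  ruleAt? Φ Ψ₁ (inj₁ a ∷ _) = no λ ()
  ruleAt? Φ Ψ₁ (inj₂ ρ ∷ _) =
    splits? (λ Φ₁ Φ' → length (tgt Φ₁) ≟ length (src Ψ₁) ×-dec lettersPrefix? (length (lhs ρ)) Φ') Φ

  Candidate : W → W → Set
  Candidate Φ Ψ = ∃₂ λ Ψ₁ Ψ' → Ψ ≡ Ψ₁ ++ Ψ' × RuleAt Φ Ψ₁ Ψ'

  witness⇒candidate : ∀ {Φ Ψ} → LoathWitness Φ Ψ → Candidate Φ Ψ
  witness⇒candidate w =
    Ψ₁ , inj₂ rule ∷ Ψ₂ , Ψ-split , Φ₁ , letters R (lhs rule) ++ Φ₂ , Φ-split , cong length aligned ,
    lhs rule , Φ₂ , refl , refl
    where open LoathWitness w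

  candidate⇒witness : ∀ {Φ Ψ} → tgt Φ ≡ src Ψ → Candidate Φ Ψ → LoathWitness Φ Ψ
  candidate⇒witness e (Ψ₁ , inj₂ ρ ∷ Ψ₂ , refl , Φ₁ , _ , refl , len₁ , l , Φ₂ , refl , len₂)
    with ++-cancel-length (tgt Φ₁) _ (src Ψ₁) _ len₁ (composable-split Φ₁ l Φ₂ Ψ₁ ρ Ψ₂ e)
  ... | al , e' with ++-cancel-length l _ (lhs ρ) _ len₂ e'
  ...   | refl , _ = record
    { rule = ρ ; Φ₁ = Φ₁ ; Φ₂ = Φ₂ ; Ψ₁ = Ψ₁ ; Ψ₂ = Ψ₂ ; Φ-split = refl ; Ψ-split = refl ; aligned = al }

  witness? : ∀ {Φ Ψ} → tgt Φ ≡ src Ψ → Dec (LoathWitness Φ Ψ)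
  witness? {Φ} {Ψ} e = map′ (candidate⇒witness e) witness⇒candidate (splits? (ruleAt? Φ) Ψ)

  -- Sliding a loath step into the preceding multistep

  interchange₃ : ∀ {A B α β C D a b c x y z d e f} →
                 A ⦂ a ⇒ b → B ⦂ b ⇒ c → α ⦂ x ⇒ y → β ⦂ y ⇒ z → C ⦂ d ⇒ e → D ⦂ e ⇒ f →
                 (A ⊗ (α ⊗ C)) ∙ (B ⊗ (β ⊗ D)) ≋ (A ∙ B) ⊗ ((α ∙ β) ⊗ (C ∙ D))
  interchange₃ A⦂ B⦂ α⦂ β⦂ C⦂ D⦂ =
    ≈-trans (interchange A⦂ B⦂ (⊗⇒ α⦂ C⦂) (⊗⇒ β⦂ D⦂))
            (≈-⊗ (≋-refl (∙⇒ A⦂ B⦂)) (interchange α⦂ β⦂ C⦂ D⦂))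

  ∙-cong-framed : ∀ {A B α β α' β' C D a b c x y y' z d e f} →
                  A ⦂ a ⇒ b → B ⦂ b ⇒ c → C ⦂ d ⇒ e → D ⦂ e ⇒ f →
                  α ⦂ x ⇒ y → β ⦂ y ⇒ z → α' ⦂ x ⇒ y' → β' ⦂ y' ⇒ z → α ∙ β ≋ α' ∙ β' →
                  (A ⊗ (α ⊗ C)) ∙ (B ⊗ (β ⊗ D)) ≋ (A ⊗ (α' ⊗ C)) ∙ (B ⊗ (β' ⊗ D))
  ∙-cong-framed {A} {B} {α} {β} {α'} {β'} {C} {D} A⦂ B⦂ C⦂ D⦂ α⦂ β⦂ α'⦂ β'⦂ αβ≋α'β' = begin
    (A ⊗ (α ⊗ C)) ∙ (B ⊗ (β ⊗ D))      ≈⟨ interchange₃ A⦂ B⦂ α⦂ β⦂ C⦂ D⦂ ⟩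
    (A ∙ B) ⊗ ((α ∙ β) ⊗ (C ∙ D))      ≈⟨ ≈-⊗ (≋-refl (∙⇒ A⦂ B⦂)) (≈-⊗ αβ≋α'β' (≋-refl (∙⇒ C⦂ D⦂))) ⟩
    (A ∙ B) ⊗ ((α' ∙ β') ⊗ (C ∙ D))    ≈⟨ interchange₃ A⦂ B⦂ α'⦂ β'⦂ C⦂ D⦂ ⟨
    (A ⊗ (α' ⊗ C)) ∙ (B ⊗ (β' ⊗ D))    ∎

  rule-slides : ∀ ρ → idTerm (lhs ρ) ∙ rl ρ ≋ rl ρ ∙ idTerm (rhs ρ)
  rule-slides ρ = ≈-trans (∙-unitˡ (idTerm-string (lhs ρ)) (idTerm-⦂ (lhs ρ)) (rl⇒ ρ))
                          (≈-sym (∙-unitʳ (idTerm-string (rhs ρ)) (rl⇒ ρ) (idTerm-⦂ (rhs ρ))))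

  toTerm-++₃ : ∀ u v w → toTerm (u ++ v ++ w) ≋ toTerm u ⊗ (toTerm v ⊗ toTerm w)
  toTerm-++₃ u v w = ≈-trans (toTerm-++ u (v ++ w)) (≈-⊗ (≋-refl (toTerm-⦂ u)) (toTerm-++ v w))

  #ʳ-split : ∀ w₁ l w₂ → #ʳ (w₁ ++ letters R l ++ w₂) ≡ #ʳ w₁ + #ʳ w₂
  #ʳ-split w₁ l w₂ = trans (#ʳ-++ w₁ _) (cong (#ʳ w₁ +_) (#ʳ-letters-++ l w₂))

  #ʳ-rule-split : ∀ w₁ ρ w₂ → #ʳ (w₁ ++ inj₂ ρ ∷ w₂) ≡ suc (#ʳ w₁ + #ʳ w₂)
  #ʳ-rule-split w₁ ρ w₂ = trans (#ʳ-++ w₁ _) (+-suc (#ʳ w₁) (#ʳ w₂))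

  module _ {Φ Ψ : W} (w : LoathWitness Φ Ψ) where
    open LoathWitness w

    hastened remainder : W
    hastened = Φ₁ ++ inj₂ rule ∷ Φ₂
    remainder = Ψ₁ ++ letters R (rhs rule) ++ Ψ₂

    #hastened : #ʳ hastened ≡ suc (#ʳ Φ)
    #hastened = trans (#ʳ-rule-split Φ₁ rule Φ₂)
                      (cong suc (sym (trans (cong #ʳ Φ-split) (#ʳ-split Φ₁ (lhs rule) Φ₂))))

    #remainder : #ʳ Ψ ≡ suc (#ʳ remainder)
    #remainder = trans (cong #ʳ Ψ-split)
                       (trans (#ʳ-rule-split Ψ₁ rule Ψ₂) (cong suc (sym (#ʳ-split Ψ₁ (rhs rule) Ψ₂))))

    hastened-src : src hastened ≡ src Φ
    hastened-src = trans (concatMap-++ srcSym Φ₁ _)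
                         (sym (trans (cong src Φ-split) (src-split Φ₁ (lhs rule) Φ₂)))

    remainder-tgt : tgt remainder ≡ tgt Ψ
    remainder-tgt = trans (tgt-split Ψ₁ (rhs rule) Ψ₂)
                          (sym (trans (cong tgt Ψ-split) (concatMap-++ tgtSym Ψ₁ _)))

    module _ (composable : tgt Φ ≡ src Ψ) where
      tails-aligned : tgt Φ₂ ≡ src Ψ₂
      tails-aligned = ++-cancelˡ (lhs rule) _ _
        (proj₂ (++-cancel-length (tgt Φ₁) _ (src Ψ₁) _ (cong length aligned)
                 (composable-split Φ₁ (lhs rule) Φ₂ Ψ₁ rule Ψ₂
                   (subst₂ (λ Φ Ψ → tgt Φ ≡ src Ψ) Φ-split Ψ-split composable))))

      hastened-tgt : tgt hastened ≡ src remainder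
      hastened-tgt = trans (concatMap-++ tgtSym Φ₁ _)
                           (trans (cong₂ (λ u v → u ++ rhs rule ++ v) aligned tails-aligned)
                                  (sym (src-split Ψ₁ (rhs rule) Ψ₂)))

      slide : toTerm Φ ∙ toTerm Ψ ≋ toTerm hastened ∙ toTerm remainder
      slide = begin
        toTerm Φ ∙ toTerm Ψ
          ≈⟨ ∙-cong (toTerm-⦂ Φ) (retype (toTerm-⦂ Ψ) (sym composable) refl)
                    (⊗⇒ Φ₁⦂ (⊗⇒ lhs⦂ Φ₂⦂)) (⊗⇒ Ψ₁⦂ (⊗⇒ (rl⇒ rule) Ψ₂⦂))
                    (subst (λ v → toTerm v ≋ _) (sym Φ-split) (toTerm-++₃ Φ₁ (letters R (lhs rule)) Φ₂))
                    (subst (λ v → toTerm v ≋ _) (sym Ψ-split) (toTerm-++ Ψ₁ (inj₂ rule ∷ Ψ₂))) ⟩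
        (toTerm Φ₁ ⊗ (idTerm (lhs rule) ⊗ toTerm Φ₂)) ∙ (toTerm Ψ₁ ⊗ (rl rule ⊗ toTerm Ψ₂))
          ≈⟨ ∙-cong-framed Φ₁⦂ Ψ₁⦂ Φ₂⦂ Ψ₂⦂ lhs⦂ (rl⇒ rule) (rl⇒ rule) rhs⦂ (rule-slides rule) ⟩
        (toTerm Φ₁ ⊗ (rl rule ⊗ toTerm Φ₂)) ∙ (toTerm Ψ₁ ⊗ (idTerm (rhs rule) ⊗ toTerm Ψ₂))
          ≈⟨ ∙-cong (⊗⇒ Φ₁⦂ (⊗⇒ (rl⇒ rule) Φ₂⦂)) (⊗⇒ Ψ₁⦂ (⊗⇒ rhs⦂ Ψ₂⦂))
                    (toTerm-⦂ hastened) (retype (toTerm-⦂ remainder) (sym hastened-tgt) refl)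
                    (≈-sym (toTerm-++ Φ₁ (inj₂ rule ∷ Φ₂))) (≈-sym (toTerm-++₃ Ψ₁ (letters R (rhs rule)) Ψ₂)) ⟩
        toTerm hastened ∙ toTerm remainder ∎
        where
          Φ₁⦂ = toTerm-⦂ Φ₁
          Φ₂⦂ = toTerm-⦂ Φ₂
          Ψ₁⦂ = retype (toTerm-⦂ Ψ₁) (sym aligned) refl
          Ψ₂⦂ = retype (toTerm-⦂ Ψ₂) (sym tails-aligned) refl
          lhs⦂ = idTerm-⦂ (lhs rule)
          rhs⦂ = idTerm-⦂ (rhs rule)

  -- Removing loath pairs

  rules : ∀ {s t} → Reduction s t → ℕ
  rules [] = 0
  rules (m ∷ q) = #ʳ (word m) + rules q

  -- Σᵢ i · (number of rule symbols of the i-th multistep), counting from i = 1.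
  weight : ∀ {s t} → Reduction s t → ℕ
  weight [] = 0
  weight (m ∷ q) = rules (m ∷ q) + weight q

  prepend : ∀ {t u} (w : W) → tgt w ≡ t → Reduction t u → Reduction (src w) u
  prepend w e q with #ʳ w ≟ 0
  ... | no some = record { word = w ; nonempty = some ; source = refl ; target = e } ∷ q
  ... | yes none with trans (rulefree-src≡tgt w none) e
  ...   | refl = q

  rules-prepend : ∀ {t u} w (e : tgt w ≡ t) (q : Reduction t u) → rules (prepend w e q) ≡ #ʳ w + rules q
  rules-prepend w e q with #ʳ w ≟ 0
  ... | no _ = refl
  ... | yes none with trans (rulefree-src≡tgt w none) e
  ...   | refl = cong (_+ rules q) (sym none)

  weight-prepend : ∀ {t u} w (e : tgt w ≡ t) (q : Reduction t u) →
                   weight (prepend w e q) ≤ (#ʳ w + rules q) + weight q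
  weight-prepend w e q with #ʳ w ≟ 0
  ... | no _ = ≤-refl
  ... | yes none with trans (rulefree-src≡tgt w none) e
  ...   | refl = m≤n+m (weight q) _

  ⟦prepend⟧ : ∀ {t u} w (e : tgt w ≡ t) (q : Reduction t u) → ⟦ prepend w e q ⟧ ≋ toTerm w ∙ ⟦ q ⟧
  ⟦prepend⟧ w e q with #ʳ w ≟ 0
  ... | no some = ⟦∷⟧ _ q
  ... | yes none with trans (rulefree-src≡tgt w none) e
  ...   | refl = ≈-sym (∙-unitˡ (toTerm-string w none) (retype (toTerm-⦂ w) refl e) (⟦⟧-⦂ q))

  record Improvement {s t} (q : Reduction s t) : Set where
    field
      improved   : Reduction s t
      same-rules : rules improved ≡ rules q
      lighter    : weight improved < weight q
      equivalent : ⟦ q ⟧ ≋ ⟦ improved ⟧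

  open Improvement

  improve-tail : ∀ {s t u} (m : Multistep⁺ s t) {q : Reduction t u} → Improvement q → Improvement (m ∷ q)
  improve-tail m {q} i = record
    { improved   = m ∷ improved i
    ; same-rules = cong (#ʳ (word m) +_) (same-rules i)
    ; lighter    = +-mono-≤-< (≤-reflexive (cong (#ʳ (word m) +_) (same-rules i))) (lighter i)
    ; equivalent = begin
        ⟦ m ∷ q ⟧                ≈⟨ ⟦∷⟧ m q ⟩
        term m ∙ ⟦ q ⟧           ≈⟨ ∙-cong m⦂ (⟦⟧-⦂ q) m⦂ (⟦⟧-⦂ (improved i)) (≋-refl m⦂) (equivalent i) ⟩
        term m ∙ ⟦ improved i ⟧  ≈⟨ ⟦∷⟧ m (improved i) ⟨
        ⟦ m ∷ improved i ⟧       ∎ }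
    where m⦂ = term-⦂ m

  slide-improvement : ∀ {s t u v} (m₁ : Multistep⁺ s t) (m₂ : Multistep⁺ t u) (q : Reduction u v) →
                      LoathWitness (word m₁) (word m₂) → Improvement (m₁ ∷ m₂ ∷ q)
  slide-improvement {u = u} {v} m₁ m₂ q w = record
    { improved   = m₁' ∷ rest
    ; same-rules = same
    ; lighter    = +-mono-≤-< (≤-reflexive same)
                     (≤-<-trans (weight-prepend (remainder w) rest-tgt q)
                                (subst (λ n → _ < (n + rules q) + weight q) (sym (#remainder w)) (n<1+n _)))
    ; equivalent = begin
        term m₁ ∙ ⟦ m₂ ∷ q ⟧
          ≈⟨ ∙-cong m₁⦂ (⟦⟧-⦂ (m₂ ∷ q)) m₁⦂ (∙⇒ m₂⦂ q⦂) (≋-refl m₁⦂) (⟦∷⟧ m₂ q) ⟩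
        term m₁ ∙ (term m₂ ∙ ⟦ q ⟧)
          ≈⟨ ∙-assoc m₁⦂ m₂⦂ q⦂ ⟨
        (term m₁ ∙ term m₂) ∙ ⟦ q ⟧
          ≈⟨ ∙-cong (∙⇒ m₁⦂ m₂⦂) q⦂ (∙⇒ h⦂ r⦂) q⦂ (slide w composable) (≋-refl q⦂) ⟩
        (toTerm (hastened w) ∙ toTerm (remainder w)) ∙ ⟦ q ⟧
          ≈⟨ ∙-assoc h⦂ r⦂ q⦂ ⟩
        toTerm (hastened w) ∙ (toTerm (remainder w) ∙ ⟦ q ⟧)
          ≈⟨ ∙-cong h⦂ (∙⇒ r⦂ q⦂) h⦂ (⟦⟧-⦂ rest) (≋-refl h⦂) (≈-sym (⟦prepend⟧ (remainder w) rest-tgt q)) ⟩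
        term m₁' ∙ ⟦ rest ⟧
          ≈⟨ ⟦∷⟧ m₁' rest ⟨
        ⟦ m₁' ∷ rest ⟧ ∎ }
    where
      composable : tgt (word m₁) ≡ src (word m₂)
      composable = trans (target m₁) (sym (source m₂))
      rest-tgt : tgt (remainder w) ≡ u
      rest-tgt = trans (remainder-tgt w) (target m₂)
      m₁' : Multistep⁺ _ (src (remainder w))
      m₁' = record
        { word     = hastened w
        ; nonempty = 1+n≢0 ∘ trans (sym (#hastened w))
        ; source   = trans (hastened-src w) (source m₁)
        ; target   = hastened-tgt w composable }
      rest : Reduction (src (remainder w)) v
      rest = prepend (remainder w) rest-tgt q
      same : rules (m₁' ∷ rest) ≡ rules (m₁ ∷ m₂ ∷ q)
      same = trans (cong₂ _+_ (#hastened w) (rules-prepend (remainder w) rest-tgt q))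
                   (trans (sym (+-suc (#ʳ (word m₁)) _))
                          (cong (λ n → #ʳ (word m₁) + (n + rules q)) (sym (#remainder w))))
      m₁⦂ = term-⦂ m₁
      m₂⦂ = term-⦂ m₂
      q⦂ = ⟦⟧-⦂ q
      h⦂ = term-⦂ m₁'
      r⦂ = retype (toTerm-⦂ (remainder w)) refl rest-tgt

  data LoathFree : ∀ {s t} → Reduction s t → Set where
    []  : ∀ {s} → LoathFree ([] {s})
    [-] : ∀ {s t} {m : Multistep⁺ s t} → LoathFree (m ∷ [])
    _∷_ : ∀ {s t u v} {m : Multistep⁺ s t} {m' : Multistep⁺ t u} {q : Reduction u v} →
          ¬ Loath R (word m) (word m') → LoathFree (m' ∷ q) → LoathFree (m ∷ m' ∷ q)

  improve : ∀ {s t} (q : Reduction s t) → LoathFree q ⊎ Improvement q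
  improve [] = inj₁ []
  improve (m ∷ []) = inj₁ [-]
  improve (m₁ ∷ m₂ ∷ q) with witness? (trans (target m₁) (sym (source m₂))) | improve (m₂ ∷ q)
  ... | yes w | _        = inj₂ (slide-improvement m₁ m₂ q w)
  ... | no ¬w | inj₁ free = inj₁ ((¬w ∘ loath⇒witness) ∷ free)
  ... | no _  | inj₂ i    = inj₂ (improve-tail m₁ i)

  greedify : ∀ {s t} (q : Reduction s t) → Σ (Reduction s t) λ q' → LoathFree q' × ⟦ q ⟧ ≋ ⟦ q' ⟧
  greedify q = go q (<-wellFounded (weight q))
    where
      go : ∀ {s t} (q : Reduction s t) → Acc _<_ (weight q) →
           Σ (Reduction s t) λ q' → LoathFree q' × ⟦ q ⟧ ≋ ⟦ q' ⟧
      go q (acc rec) with improve q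
      ... | inj₁ free = q , free , ≋-refl (⟦⟧-⦂ q)
      ... | inj₂ i with go (improved i) (rec (lighter i))
      ...   | q' , free , ≋q' = q' , free , ≈-trans (equivalent i) ≋q'

  -- Loath-free reductions are greedy

  headMS-⟦∷⟧ : ∀ {s t u} (m : Multistep⁺ s t) (q : Reduction t u) → headMS R ⟦ m ∷ q ⟧ ≡ term m
  headMS-⟦∷⟧ m [] = headMS-toTerm (word m)
  headMS-⟦∷⟧ m (_ ∷ _) = refl

  greedyNE : ∀ {s t u} (m : Multistep⁺ s t) (q : Reduction t u) → LoathFree (m ∷ q) → GreedyNE R ⟦ m ∷ q ⟧
  greedyNE m [] [-] = one (toTerm-multistep (word m)) (nonempty m ∘ trans (sym (#rules-toTerm (word m))))
  greedyNE m (m' ∷ q) (¬loath ∷ free) =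
    cons (toTerm-multistep (word m)) (nonempty m ∘ trans (sym (#rules-toTerm (word m)))) (greedyNE m' q free)
         (¬loath ∘ subst₂ (Loath R) (flat-toTerm (word m))
                                     (trans (cong (flat R) (headMS-⟦∷⟧ m' q)) (flat-toTerm (word m'))))

  greedy : ∀ {s t} {q : Reduction s t} → LoathFree q → Greedy R ⟦ q ⟧
  greedy [] = inj₁ (idTerm-string _)
  greedy free@[-] = inj₂ (greedyNE _ _ free)
  greedy free@(_ ∷ _) = inj₂ (greedyNE _ _ free)

lemma31 : (R : SRS) → ∀ (γ : Term R) (s t : List (SRS.Alph R)) →
    _∶_⇒_ R γ s t → ∃[ γ' ] (Greedy R γ' × _≈_ R γ γ')
lemma31 R γ s t γ⦂ =
  let q , γ≋q = normalise γ⦂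
      q' , free , q≋q' = greedify q
  in ⟦ q' ⟧ , greedy free , ≈-trans γ≋q q≋q'
  where open Greedification R
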